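{- For $n\geq 0$ let $a_n$ be the number of even-up Catalan words of length $n$ and $b_n$ the number of odd-up Catalan words of length $n$, and let $A(x)=\sum_{n\geq 0}a_nx^n$, $B(x)=\sum_{n\geq 0}b_nx^n$. Then \[A(x)=\frac{2-x}{2x}-\frac{(2+x)\sqrt{(1+x)(1-3x)}}{2x(1+x)},\qquad B(x)=\frac{1-\sqrt{(1+x)(1-3x)}}{x(1+x)}.\]
   Context: A Catalan word of length $n$ is a word $w_1\cdots w_n\in\{1,\ldots,n\}^n$ with $w_1=1$ and $w_{i+1}\leq w_i+1$ for every $i\in\{1,\ldots,n-1\}$; for $n=0$ the empty word is the unique Catalan word. A word $w_1\cdots w_n$ is even-up if for every $i\in\{1,\ldots,n-1\}$, whenever $w_i$ is even, $w_{i+1}>w_i$; it is odd-up if for every $i\in\{1,\ldots,n-1\}$, whenever $w_i$ is odd, $w_{i+1}>w_i$. The square roots denote the power series branch with constant term $1$. -}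

module Defs where

open import Data.Bool using (Bool; true; false; _∧_; if_then_else_)
open import Data.Nat as ℕ using (ℕ; zero; suc)
open import Data.Nat.Base using (_≤ᵇ_; _<ᵇ_)
open import Data.List using (List; []; _∷_; [_]; map; concatMap; length; filter; upTo)
open import Data.Integer as ℤ using (ℤ; +_)
open import Relation.Binary.PropositionalEquality using (_≡_)
open import Relation.Nullary.Decidable using (does)
import Data.Bool.Properties

wordsOver : ℕ → ℕ → List (List ℕ)
wordsOver m zero    = [ [] ]
wordsOver m (suc k) =
  concatMap (λ w → map (λ i → suc i ∷ w) (upTo m)) (wordsOver m k)

adjAll : (ℕ → ℕ → Bool) → List ℕ → Bool
adjAll R []            = true
adjAll R (x ∷ [])      = true
adjAll R (x ∷ y ∷ ws)  = R x y ∧ adjAll R (y ∷ ws)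

-- Catalan word (entries in {1..n} guaranteed by enumeration):
-- w_1 = 1 and w_{i+1} ≤ w_i + 1; the empty word is Catalan
isCatalan : List ℕ → Bool
isCatalan []       = true
isCatalan (x ∷ ws) = (x ℕ.≡ᵇ 1) ∧ adjAll (λ a b → b ≤ᵇ suc a) (x ∷ ws)

isEven : ℕ → Bool
isEven zero          = true
isEven (suc zero)    = false
isEven (suc (suc n)) = isEven n

evenUp : List ℕ → Bool
evenUp = adjAll (λ a b → if isEven a then a <ᵇ b else true)

oddUp : List ℕ → Bool
oddUp = adjAll (λ a b → if isEven a then true else a <ᵇ b)

a : ℕ → ℕ
a n = length (filter (λ w → (isCatalan w ∧ evenUp w) Data.Bool.Properties.≟ true) (wordsOver n n))

b : ℕ → ℕ
b n = length (filter (λ w → (isCatalan w ∧ oddUp w) Data.Bool.Properties.≟ true) (wordsOver n n))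

Series : Set
Series = ℕ → ℤ

sumTo : (ℕ → ℤ) → ℕ → ℤ
sumTo f zero    = f zero
sumTo f (suc n) = sumTo f n ℤ.+ f (suc n)

_⊕_ : Series → Series → Series
(f ⊕ g) n = f n ℤ.+ g n

_⊖_ : Series → Series → Series
(f ⊖ g) n = f n ℤ.- g n

_⊛_ : Series → Series → Series
(f ⊛ g) n = sumTo (λ i → f i ℤ.* g (n ℕ.∸ i)) n

infixl 6 _⊕_ _⊖_
infixl 7 _⊛_
infix 4 _≐_

_≐_ : Series → Series → Set
f ≐ g = ∀ n → f n ≡ g n

poly : ℤ → ℤ → ℤ → Series
poly c0 c1 c2 zero             = c0
poly c0 c1 c2 (suc zero)       = c1
poly c0 c1 c2 (suc (suc zero)) = c2
poly c0 c1 c2 (suc (suc (suc _))) = + 0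

ogf : (ℕ → ℕ) → Series
ogf s n = + s n

{-# OPTIONS --safe #-}
-- Both families are counted by walks on the letters 1, 2, … in which a letter c may be followed
-- by any letter ≤ c + 1, with the obligation to rise after even (resp. odd) letters. Cutting a
-- walk where it first returns to the letter 1, and noting that raising every letter by one swaps
-- the roles of even and odd letters, gives for A, B and for the series T, F of the walks that
-- may end with a step down to a ground letter 0
--   A = 1 + x(B + F(A − 1)),  B = 1 + x(A + T(B − 1)),  T = xF(1 + T),  F = 1 + xTF.
-- Eliminating F gives x(1 + T)² = (1 + x)T, so √Δ = 1 − x − 2xT satisfies
-- √Δ² = (1 + x)(1 − 3x).
-- The claimed formulas say that U = (1 + x)B − 1 − 2T and V = (1 + x)A − 1 − 2T − xT vanish;
-- they satisfy U = x(V + TU) and V = x(U + FV), whose only solution is zero because each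
-- coefficient is determined by the earlier ones.
module Submission where

open import Defs
open import Algebra.Bundles using (Ring)

module LinearCombination {c ℓ} (R : Ring c ℓ) where

  open Ring R
  open import Algebra.Properties.Group +-group using (x∙y⁻¹≈ε⇒x≈y; x≈y⇒x∙y⁻¹≈ε)

  private
    multiple-vanishes : ∀ k {l r} → l ≈ r → k * (l - r) ≈ 0#
    multiple-vanishes k l≈r = trans (*-congˡ (x≈y⇒x∙y⁻¹≈ε l≈r)) (zeroʳ k)

  linear-combination₁ : ∀ {lhs rhs l r} k →
                        lhs - rhs ≈ k * (l - r) → l ≈ r → lhs ≈ rhs
  linear-combination₁ {lhs} {rhs} k eq h = x∙y⁻¹≈ε⇒x≈y lhs rhs (trans eq (multiple-vanishes k h))

  linear-combination₂ : ∀ {lhs rhs l₁ r₁ l₂ r₂} k₁ k₂ →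
                        lhs - rhs ≈ k₁ * (l₁ - r₁) + k₂ * (l₂ - r₂) →
                        l₁ ≈ r₁ → l₂ ≈ r₂ → lhs ≈ rhs
  linear-combination₂ {lhs} {rhs} k₁ k₂ eq h₁ h₂ = x∙y⁻¹≈ε⇒x≈y lhs rhs (trans eq (trans
    (+-cong (multiple-vanishes k₁ h₁) (multiple-vanishes k₂ h₂)) (+-identityʳ 0#)))

  linear-combination₃ : ∀ {lhs rhs l₁ r₁ l₂ r₂ l₃ r₃} k₁ k₂ k₃ →
                        lhs - rhs ≈ k₁ * (l₁ - r₁) + k₂ * (l₂ - r₂) + k₃ * (l₃ - r₃) →
                        l₁ ≈ r₁ → l₂ ≈ r₂ → l₃ ≈ r₃ → lhs ≈ rhs
  linear-combination₃ {lhs} {rhs} k₁ k₂ k₃ eq h₁ h₂ h₃ = x∙y⁻¹≈ε⇒x≈y lhs rhs (trans eq (trans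
    (+-cong (trans (+-cong (multiple-vanishes k₁ h₁) (multiple-vanishes k₂ h₂)) (+-identityʳ 0#))
            (multiple-vanishes k₃ h₃))
    (+-identityʳ 0#)))

module PowerSeries where

  open import Algebra.Bundles using (CommutativeRing)
  open import Algebra.Structures using (IsCommutativeRing)
  import Algebra.Construct.Pointwise as Pointwise
  open import Algebra.Solver.Ring.AlmostCommutativeRing
    using (fromCommutativeRing; _-Raw-AlmostCommutative⟶_)
  open import Data.Integer using (ℤ; +_; -_; _+_; _*_; _≟_)
  open import Data.Integer.Properties
  open import Data.Integer.Tactic.RingSolver using (solve-∀)
  open import Algebra.Properties.CommutativeSemigroup +-commutativeSemigroup using (interchange)
  open import Data.Maybe using (Maybe; just; nothing)
  open import Data.Product using (_×_; _,_; proj₁; proj₂)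
  open import Data.Nat as ℕ using (ℕ; zero; suc; _∸_; _≤_; _<_; z≤n; s≤s)
  import Data.Nat.Properties as ℕ
  open import Relation.Binary.PropositionalEquality
  open import Relation.Nullary using (yes; no)
  open ≡-Reasoning

  shift : Series → Series
  shift f n = f (suc n)

  sumTo-cong : ∀ {f g} n → (∀ i → i ≤ n → f i ≡ g i) → sumTo f n ≡ sumTo g n
  sumTo-cong zero    f≗g = f≗g 0 z≤n
  sumTo-cong (suc n) f≗g =
    cong₂ _+_ (sumTo-cong n (λ i i≤n → f≗g i (ℕ.m≤n⇒m≤1+n i≤n))) (f≗g (suc n) ℕ.≤-refl)

  sumTo-zero : ∀ n → sumTo (λ _ → + 0) n ≡ + 0
  sumTo-zero zero    = refl
  sumTo-zero (suc n) = cong (_+ + 0) (sumTo-zero n)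

  sumTo-+ : ∀ f g n → sumTo (λ i → f i + g i) n ≡ sumTo f n + sumTo g n
  sumTo-+ f g zero    = refl
  sumTo-+ f g (suc n) = begin
    sumTo (λ i → f i + g i) n + (f (suc n) + g (suc n))
      ≡⟨ cong (_+ (f (suc n) + g (suc n))) (sumTo-+ f g n) ⟩
    sumTo f n + sumTo g n + (f (suc n) + g (suc n))
      ≡⟨ interchange (sumTo f n) (sumTo g n) (f (suc n)) (g (suc n)) ⟩
    sumTo f n + f (suc n) + (sumTo g n + g (suc n)) ∎

  sumTo-*ˡ : ∀ c f n → c * sumTo f n ≡ sumTo (λ i → c * f i) n
  sumTo-*ˡ c f zero    = refl
  sumTo-*ˡ c f (suc n) =
    trans (*-distribˡ-+ c (sumTo f n) (f (suc n))) (cong (_+ c * f (suc n)) (sumTo-*ˡ c f n))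

  sumTo-sucˡ : ∀ f n → sumTo f (suc n) ≡ f 0 + sumTo (shift f) n
  sumTo-sucˡ f zero    = refl
  sumTo-sucˡ f (suc n) =
    trans (cong (_+ f (suc (suc n))) (sumTo-sucˡ f n)) (+-assoc (f 0) _ _)

  sumTo-reverse : ∀ f n → sumTo f n ≡ sumTo (λ i → f (n ∸ i)) n
  sumTo-reverse f zero    = refl
  sumTo-reverse f (suc n) = begin
    sumTo f n + f (suc n)                   ≡⟨ cong (_+ f (suc n)) (sumTo-reverse f n) ⟩
    sumTo (λ i → f (n ∸ i)) n + f (suc n)   ≡⟨ +-comm _ (f (suc n)) ⟩
    f (suc n) + sumTo (λ i → f (n ∸ i)) n   ≡⟨ sumTo-sucˡ (λ i → f (suc n ∸ i)) n ⟨
    sumTo (λ i → f (suc n ∸ i)) (suc n)     ∎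

  ⊛-cong : ∀ {f f′ g g′} → f ≐ f′ → g ≐ g′ → f ⊛ g ≐ f′ ⊛ g′
  ⊛-cong f≐f′ g≐g′ n = sumTo-cong n (λ i _ → cong₂ _*_ (f≐f′ i) (g≐g′ (n ∸ i)))

  shift-⊛ : ∀ f g → shift (f ⊛ g) ≐ (λ n → f 0 * g (suc n)) ⊕ shift f ⊛ g
  shift-⊛ f g n = sumTo-sucˡ (λ i → f i * g (suc n ∸ i)) n

  ⊛-comm : ∀ f g → f ⊛ g ≐ g ⊛ f
  ⊛-comm f g n = begin
    sumTo (λ i → f i * g (n ∸ i)) n              ≡⟨ sumTo-reverse _ n ⟩
    sumTo (λ i → f (n ∸ i) * g (n ∸ (n ∸ i))) n  ≡⟨ sumTo-cong n swap ⟩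
    sumTo (λ i → g i * f (n ∸ i)) n              ∎
    where
    swap : ∀ i → i ≤ n → f (n ∸ i) * g (n ∸ (n ∸ i)) ≡ g i * f (n ∸ i)
    swap i i≤n = trans (cong (λ j → f (n ∸ i) * g j) (ℕ.m∸[m∸n]≡n i≤n)) (*-comm (f (n ∸ i)) (g i))

  ⊛-distribʳ : ∀ h f g → (f ⊕ g) ⊛ h ≐ f ⊛ h ⊕ g ⊛ h
  ⊛-distribʳ h f g n =
    trans (sumTo-cong n (λ i _ → *-distribʳ-+ (h (n ∸ i)) (f i) (g i))) (sumTo-+ _ _ n)

  ⊛-distribˡ : ∀ h f g → h ⊛ (f ⊕ g) ≐ h ⊛ f ⊕ h ⊛ g
  ⊛-distribˡ h f g n =
    trans (sumTo-cong n (λ i _ → *-distribˡ-+ (h i) (f (n ∸ i)) (g (n ∸ i)))) (sumTo-+ _ _ n)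

  ⊛-scaleˡ : ∀ c f g → (λ i → c * f i) ⊛ g ≐ (λ n → c * (f ⊛ g) n)
  ⊛-scaleˡ c f g n =
    trans (sumTo-cong n (λ i _ → *-assoc c (f i) (g (n ∸ i)))) (sym (sumTo-*ˡ c _ n))

  ⊛-assoc : ∀ f g h → (f ⊛ g) ⊛ h ≐ f ⊛ (g ⊛ h)
  ⊛-assoc f g h zero    = *-assoc (f 0) (g 0) (h 0)
  ⊛-assoc f g h (suc n) = begin
    ((f ⊛ g) ⊛ h) (suc n)
      ≡⟨ shift-⊛ (f ⊛ g) h n ⟩
    lead + (shift (f ⊛ g) ⊛ h) n
      ≡⟨ cong (_+_ lead) (⊛-cong {g = h} (shift-⊛ f g) (λ _ → refl) n) ⟩
    lead + (((λ i → f 0 * g (suc i)) ⊕ shift f ⊛ g) ⊛ h) n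
      ≡⟨ cong (_+_ lead) (⊛-distribʳ h (λ i → f 0 * g (suc i)) (shift f ⊛ g) n) ⟩
    lead + (((λ i → f 0 * g (suc i)) ⊛ h) n + ((shift f ⊛ g) ⊛ h) n)
      ≡⟨ cong (_+_ lead) (cong₂ _+_ (⊛-scaleˡ (f 0) (shift g) h n) (⊛-assoc (shift f) g h n)) ⟩
    lead + (f 0 * (shift g ⊛ h) n + (shift f ⊛ (g ⊛ h)) n)
      ≡⟨ regroup (f 0) (g 0) (h (suc n)) ((shift g ⊛ h) n) _ ⟩
    f 0 * (g 0 * h (suc n) + (shift g ⊛ h) n) + (shift f ⊛ (g ⊛ h)) n
      ≡⟨ cong (λ x → f 0 * x + (shift f ⊛ (g ⊛ h)) n) (shift-⊛ g h n) ⟨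
    f 0 * (g ⊛ h) (suc n) + (shift f ⊛ (g ⊛ h)) n
      ≡⟨ shift-⊛ f (g ⊛ h) n ⟨
    (f ⊛ (g ⊛ h)) (suc n) ∎
    where
    lead : ℤ
    lead = f 0 * g 0 * h (suc n)
    regroup : ∀ a b c y z → a * b * c + (a * y + z) ≡ a * (b * c + y) + z
    regroup = solve-∀

  const : ℤ → Series
  const c zero    = c
  const c (suc _) = + 0

  const-⊛ : ∀ c f → const c ⊛ f ≐ (λ n → c * f n)
  const-⊛ c f zero    = refl
  const-⊛ c f (suc n) =
    trans (shift-⊛ (const c) f n) (trans (cong (_+_ (c * f (suc n))) (sumTo-zero n)) (+-identityʳ _))

  ⊛-identityˡ : ∀ f → const (+ 1) ⊛ f ≐ f
  ⊛-identityˡ f n = trans (const-⊛ (+ 1) f n) (*-identityˡ (f n))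

  ⊛-isCommutativeRing : IsCommutativeRing _≐_ _⊕_ _⊛_ (λ f n → - f n) (λ _ → + 0) (const (+ 1))
  ⊛-isCommutativeRing = record
    { isRing = record
      { +-isAbelianGroup = Pointwise.isAbelianGroup ℕ +-0-isAbelianGroup
      ; *-cong           = ⊛-cong
      ; *-assoc          = ⊛-assoc
      ; *-identity       = ⊛-identityˡ , λ f n → trans (⊛-comm f (const (+ 1)) n) (⊛-identityˡ f n)
      ; distrib          = ⊛-distribˡ , ⊛-distribʳ
      }
    ; *-comm = ⊛-comm
    }

  seriesRing : CommutativeRing _ _
  seriesRing = record { isCommutativeRing = ⊛-isCommutativeRing }

  const-homomorphism : CommutativeRing.rawRing +-*-commutativeRing
                         -Raw-AlmostCommutative⟶ fromCommutativeRing seriesRing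
  const-homomorphism = record
    { ⟦_⟧    = const
    ; +-homo = λ { c d zero → refl ; c d (suc n) → refl }
    ; *-homo = λ c d n → sym (trans (const-⊛ c (const d) n) (const-* c d n))
    ; -‿homo = λ { c zero → refl ; c (suc n) → refl }
    ; 0-homo = λ { zero → refl ; (suc n) → refl }
    ; 1-homo = λ { zero → refl ; (suc n) → refl }
    }
    where
    const-* : ∀ c d n → c * const d n ≡ const (c * d) n
    const-* c d zero    = refl
    const-* c d (suc n) = *-zeroʳ c

  const-≟ : ∀ c d → Maybe (const c ≐ const d)
  const-≟ c d with c ≟ d
  ... | yes refl = just (λ _ → refl)
  ... | no _     = nothing

  open import Algebra.Solver.Ring (CommutativeRing.rawRing +-*-commutativeRing)
    (fromCommutativeRing seriesRing) const-homomorphism const-≟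
    public using (solve; _:=_; _:+_; _:*_; _:-_; con)

  X : Series
  X zero    = + 0
  X (suc n) = const (+ 1) n

  X⊛-suc : ∀ f n → (X ⊛ f) (suc n) ≡ f n
  X⊛-suc f n = trans (shift-⊛ X f n) (trans (+-identityˡ _) (⊛-identityˡ f n))

  poly≐ : ∀ c₀ c₁ c₂ → poly c₀ c₁ c₂ ≐ const c₀ ⊕ X ⊛ (const c₁ ⊕ X ⊛ const c₂)
  poly≐ c₀ c₁ c₂ zero    = sym (+-identityʳ c₀)
  poly≐ c₀ c₁ c₂ (suc n) =
    sym (trans (+-identityˡ _) (trans (X⊛-suc (const c₁ ⊕ X ⊛ const c₂) n) (linear n)))
    where
    linear : ∀ n → const c₁ n + (X ⊛ const c₂) n ≡ poly c₀ c₁ c₂ (suc n)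
    linear zero          = +-identityʳ c₁
    linear (suc zero)    = trans (+-identityˡ _) (X⊛-suc (const c₂) 0)
    linear (suc (suc n)) = trans (+-identityˡ _) (X⊛-suc (const c₂) (suc n))

  VanishesBelow : Series → ℕ → Set
  VanishesBelow f n = ∀ m → m < n → f m ≡ + 0

  ⊕-vanishesBelow : ∀ {f g n} → VanishesBelow f n → VanishesBelow g n → VanishesBelow (f ⊕ g) n
  ⊕-vanishesBelow f<n g<n m m<n = cong₂ _+_ (f<n m m<n) (g<n m m<n)

  ⊛-vanishesBelow : ∀ f {g n} → VanishesBelow g n → VanishesBelow (f ⊛ g) n
  ⊛-vanishesBelow f {g} g<n m m<n = trans (sumTo-cong m vanish) (sumTo-zero m)
    where
    vanish : ∀ i → i ≤ m → f i * g (m ∸ i) ≡ + 0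
    vanish i _ = trans (cong (f i *_) (g<n (m ∸ i) (ℕ.≤-<-trans (ℕ.m∸n≤m m i) m<n))) (*-zeroʳ (f i))

  X⊛-vanishesBelow : ∀ {f n} → VanishesBelow f n → VanishesBelow (X ⊛ f) (suc n)
  X⊛-vanishesBelow         f<n zero    _         = refl
  X⊛-vanishesBelow {f} f<n (suc m) (s≤s m<n) = trans (X⊛-suc f m) (f<n m m<n)

  vanishesBelow⇒≐0 : ∀ {f} → (∀ n → VanishesBelow f n) → f ≐ const (+ 0)
  vanishesBelow⇒≐0 f<_ zero    = (f< 1) 0 (s≤s z≤n)
  vanishesBelow⇒≐0 f<_ (suc n) = (f< suc (suc n)) (suc n) ℕ.≤-refl

  X-system-trivial : ∀ {U V G H} → U ≐ X ⊛ (V ⊕ G ⊛ U) → V ≐ X ⊛ (U ⊕ H ⊛ V) →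
                     U ≐ const (+ 0) × V ≐ const (+ 0)
  X-system-trivial {U} {V} {G} {H} hU hV =
    vanishesBelow⇒≐0 (λ n → proj₁ (vanish n)) , vanishesBelow⇒≐0 (λ n → proj₂ (vanish n))
    where
    vanish : ∀ n → VanishesBelow U n × VanishesBelow V n
    vanish zero    = (λ _ ()) , (λ _ ())
    vanish (suc n) with U<n , V<n ← vanish n =
        (λ m m<1+n → trans (hU m) (X⊛-vanishesBelow (⊕-vanishesBelow V<n (⊛-vanishesBelow G U<n)) m m<1+n))
      , (λ m m<1+n → trans (hV m) (X⊛-vanishesBelow (⊕-vanishesBelow U<n (⊛-vanishesBelow H V<n)) m m<1+n))

module Walks where

  open import Data.Bool using (Bool; true; false; _∧_; not; if_then_else_)
  open import Data.Bool.Properties using (∧-assoc; not-involutive)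
  import Data.Bool.Properties as Bool
  open import Data.List using (List; []; _∷_; _++_; map; concatMap; length; filter; upTo; applyUpTo)
  open import Data.Nat using (ℕ; zero; suc; _+_; _*_; _∸_; _≤_; _<_; _≤ᵇ_; _<ᵇ_; _≡ᵇ_; z≤n; s≤s)
  open import Data.Nat.Properties
  open import Algebra.Properties.CommutativeSemigroup +-commutativeSemigroup using (interchange; x∙yz≈y∙xz)
  open import Relation.Binary.PropositionalEquality
  open ≡-Reasoning

  sum< : ℕ → (ℕ → ℕ) → ℕ
  sum< zero    g = 0
  sum< (suc n) g = g 0 + sum< n (λ i → g (suc i))

  syntax sum< n (λ i → e) = ∑[ i < n ] e

  sum<-cong : ∀ n {g h} → (∀ i → i < n → g i ≡ h i) → sum< n g ≡ sum< n h
  sum<-cong zero    g≗h = refl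
  sum<-cong (suc n) g≗h = cong₂ _+_ (g≗h 0 (s≤s z≤n)) (sum<-cong n (λ i i<n → g≗h (suc i) (s≤s i<n)))

  sum<-zero : ∀ n {g} → (∀ i → g i ≡ 0) → sum< n g ≡ 0
  sum<-zero zero    g≗0 = refl
  sum<-zero (suc n) g≗0 = cong₂ _+_ (g≗0 0) (sum<-zero n (λ i → g≗0 (suc i)))

  sum<-+ : ∀ n g h → ∑[ i < n ] (g i + h i) ≡ sum< n g + sum< n h
  sum<-+ zero    g h = refl
  sum<-+ (suc n) g h = trans (cong (g 0 + h 0 +_) (sum<-+ n (λ i → g (suc i)) (λ i → h (suc i))))
                             (interchange (g 0) (h 0) _ _)

  sum<-*ˡ : ∀ n x g → x * sum< n g ≡ ∑[ i < n ] (x * g i)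
  sum<-*ˡ zero    x g = *-zeroʳ x
  sum<-*ˡ (suc n) x g = trans (*-distribˡ-+ x (g 0) _) (cong (x * g 0 +_) (sum<-*ˡ n x (λ i → g (suc i))))

  sum<-*ʳ : ∀ n g x → sum< n g * x ≡ ∑[ i < n ] (g i * x)
  sum<-*ʳ zero    g x = refl
  sum<-*ʳ (suc n) g x = trans (*-distribʳ-+ x (g 0) _) (cong (g 0 * x +_) (sum<-*ʳ n (λ i → g (suc i)) x))

  sum<-split : ∀ m n g → sum< (m + n) g ≡ sum< m g + ∑[ i < n ] g (m + i)
  sum<-split zero    n g = refl
  sum<-split (suc m) n g = trans (cong (g 0 +_) (sum<-split m n (λ i → g (suc i)))) (sym (+-assoc (g 0) _ _))

  sum<-truncate : ∀ {n m} g → n ≤ m → (∀ i → g (n + i) ≡ 0) → sum< m g ≡ sum< n g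
  sum<-truncate {n} {m} g n≤m beyond = begin
    sum< m g                             ≡⟨ cong (λ k → sum< k g) (m+[n∸m]≡n n≤m) ⟨
    sum< (n + (m ∸ n)) g                 ≡⟨ sum<-split n (m ∸ n) g ⟩
    sum< n g + ∑[ i < m ∸ n ] g (n + i)  ≡⟨ cong (sum< n g +_) (sum<-zero (m ∸ n) beyond) ⟩
    sum< n g + 0                         ≡⟨ +-identityʳ _ ⟩
    sum< n g                             ∎

  sum<-comm : ∀ m n f → ∑[ i < m ] sum< n (f i) ≡ ∑[ j < n ] ∑[ i < m ] f i j
  sum<-comm zero    n f = sym (sum<-zero n (λ _ → refl))
  sum<-comm (suc m) n f = trans (cong (sum< n (f 0) +_) (sum<-comm m n (λ i → f (suc i))))
                                (sym (sum<-+ n (f 0) (λ j → ∑[ i < m ] f (suc i) j)))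

  sum<-*-sum< : ∀ m n (r : ℕ → ℕ) (f : ℕ → ℕ → ℕ) (g : ℕ → ℕ) →
    ∑[ i < m ] (r i * ∑[ j < n ] (f j i * g j)) ≡ ∑[ j < n ] (∑[ i < m ] (r i * f j i) * g j)
  sum<-*-sum< m n r f g = begin
    ∑[ i < m ] (r i * ∑[ j < n ] (f j i * g j))     ≡⟨ sum<-cong m (λ i _ → sum<-*ˡ n (r i) _) ⟩
    ∑[ i < m ] ∑[ j < n ] (r i * (f j i * g j))     ≡⟨ sum<-cong m (λ i _ → sum<-cong n (λ j _ → sym (*-assoc (r i) _ _))) ⟩
    ∑[ i < m ] ∑[ j < n ] (r i * f j i * g j)       ≡⟨ sum<-comm m n (λ i j → r i * f j i * g j) ⟩
    ∑[ j < n ] ∑[ i < m ] (r i * f j i * g j)       ≡⟨ sum<-cong n (λ j _ → sym (sum<-*ʳ m _ (g j))) ⟩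
    ∑[ j < n ] (∑[ i < m ] (r i * f j i) * g j)     ∎

  indicator : Bool → ℕ
  indicator true  = 1
  indicator false = 0

  count : (List ℕ → Bool) → List (List ℕ) → ℕ
  count p []       = 0
  count p (w ∷ ws) = indicator (p w) + count p ws

  length-filter≡count : ∀ p ws → length (filter (λ w → p w Bool.≟ true) ws) ≡ count p ws
  length-filter≡count p []       = refl
  length-filter≡count p (w ∷ ws) with p w
  ... | true  = cong suc (length-filter≡count p ws)
  ... | false = length-filter≡count p ws

  count-cong : ∀ {p q} → (∀ w → p w ≡ q w) → ∀ ws → count p ws ≡ count q ws
  count-cong p≗q []       = refl
  count-cong p≗q (w ∷ ws) = cong₂ _+_ (cong indicator (p≗q w)) (count-cong p≗q ws)

  count-++ : ∀ p vs ws → count p (vs ++ ws) ≡ count p vs + count p ws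
  count-++ p []       ws = refl
  count-++ p (v ∷ vs) ws = trans (cong (indicator (p v) +_) (count-++ p vs ws)) (sym (+-assoc (indicator (p v)) _ _))

  count-∧ : ∀ b q ws → count (λ w → b ∧ q w) ws ≡ indicator b * count q ws
  count-∧ true  q ws = sym (+-identityʳ _)
  count-∧ false q []       = refl
  count-∧ false q (w ∷ ws) = count-∧ false q ws

  count-map-applyUpTo : ∀ p (g : ℕ → List ℕ) (f : ℕ → ℕ) m →
    count p (map g (applyUpTo f m)) ≡ ∑[ i < m ] indicator (p (g (f i)))
  count-map-applyUpTo p g f zero    = refl
  count-map-applyUpTo p g f (suc m) = cong (indicator (p (g (f 0))) +_) (count-map-applyUpTo p g (λ i → f (suc i)) m)

  count-prepend : ∀ p m ws →
    count p (concatMap (λ w → map (λ i → suc i ∷ w) (upTo m)) ws) ≡ ∑[ i < m ] count (λ w → p (suc i ∷ w)) ws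
  count-prepend p m []       = sym (sum<-zero m (λ _ → refl))
  count-prepend p m (w ∷ ws) = begin
    count p (map (λ i → suc i ∷ w) (upTo m) ++ concatMap (λ w → map (λ i → suc i ∷ w) (upTo m)) ws)
      ≡⟨ count-++ p (map (λ i → suc i ∷ w) (upTo m)) _ ⟩
    count p (map (λ i → suc i ∷ w) (upTo m)) + count p (concatMap (λ w → map (λ i → suc i ∷ w) (upTo m)) ws)
      ≡⟨ cong₂ _+_ (count-map-applyUpTo p (λ i → suc i ∷ w) (λ i → i) m) (count-prepend p m ws) ⟩
    ∑[ i < m ] indicator (p (suc i ∷ w)) + ∑[ i < m ] count (λ w → p (suc i ∷ w)) ws
      ≡⟨ sum<-+ m (λ i → indicator (p (suc i ∷ w))) (λ i → count (λ w → p (suc i ∷ w)) ws) ⟨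
    ∑[ i < m ] count (λ w → p (suc i ∷ w)) (w ∷ ws) ∎

  count-wordsOver-suc : ∀ p m k →
    count p (wordsOver m (suc k)) ≡ ∑[ i < m ] count (λ w → p (suc i ∷ w)) (wordsOver m k)
  count-wordsOver-suc p m k = count-prepend p m (wordsOver m k)

  count-wordsOver-suc-cong : ∀ {p q} m k → (∀ i w → p (suc i ∷ w) ≡ q (suc i ∷ w)) →
    count p (wordsOver m (suc k)) ≡ count q (wordsOver m (suc k))
  count-wordsOver-suc-cong {p} {q} m k p≗q = begin
    count p (wordsOver m (suc k))                            ≡⟨ count-wordsOver-suc p m k ⟩
    ∑[ i < m ] count (λ w → p (suc i ∷ w)) (wordsOver m k)   ≡⟨ sum<-cong m (λ i _ → count-cong (p≗q i) (wordsOver m k)) ⟩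
    ∑[ i < m ] count (λ w → q (suc i ∷ w)) (wordsOver m k)   ≡⟨ count-wordsOver-suc q m k ⟨
    count q (wordsOver m (suc k))                            ∎

  isEven-suc : ∀ c → isEven (suc c) ≡ not (isEven c)
  isEven-suc zero    = refl
  isEven-suc (suc c) = sym (trans (cong not (isEven-suc c)) (not-involutive _))

  risesOK : Bool → ℕ → ℕ → Bool
  risesOK true  c y = if isEven c then c <ᵇ y else true
  risesOK false c y = if isEven c then true else c <ᵇ y

  rising : Bool → List ℕ → Bool
  rising σ = adjAll (risesOK σ)

  step : Bool → ℕ → ℕ → Bool
  step σ c y = (y ≤ᵇ suc c) ∧ risesOK σ c y

  risesOK-suc : ∀ σ c y → risesOK σ (suc c) (suc y) ≡ risesOK (not σ) c y
  risesOK-suc true  c y rewrite isEven-suc c with isEven c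
  ... | true  = refl
  ... | false = refl
  risesOK-suc false c y rewrite isEven-suc c with isEven c
  ... | true  = refl
  ... | false = refl

  step-suc : ∀ σ c y → step σ (suc c) (suc y) ≡ step (not σ) c y
  step-suc σ c zero    = cong (true ∧_) (risesOK-suc σ c zero)
  step-suc σ c (suc y) = cong ((y <ᵇ suc c) ∧_) (risesOK-suc σ c (suc y))

  adjAll-∧ : ∀ R S ws → adjAll (λ x y → R x y ∧ S x y) ws ≡ adjAll R ws ∧ adjAll S ws
  adjAll-∧ R S []           = refl
  adjAll-∧ R S (x ∷ [])     = refl
  adjAll-∧ R S (x ∷ y ∷ ws) rewrite adjAll-∧ R S (y ∷ ws) with R x y | S x y
  ... | true  | true  = refl
  ... | true  | false = sym (Bool.∧-zeroʳ _)
  ... | false | _     = refl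

  -- The condition w₁ = 1 is a step from a virtual letter 0.
  catalan-rising≡walk : ∀ σ i w →
    isCatalan (suc i ∷ w) ∧ rising σ (suc i ∷ w) ≡ adjAll (step σ) (0 ∷ suc i ∷ w)
  catalan-rising≡walk σ i w = begin
    ((i ≡ᵇ 0) ∧ adjAll (λ x y → y ≤ᵇ suc x) (suc i ∷ w)) ∧ rising σ (suc i ∷ w)
      ≡⟨ ∧-assoc (i ≡ᵇ 0) _ _ ⟩
    (i ≡ᵇ 0) ∧ (adjAll (λ x y → y ≤ᵇ suc x) (suc i ∷ w) ∧ adjAll (risesOK σ) (suc i ∷ w))
      ≡⟨ cong₂ _∧_ (first-step σ i) (sym (adjAll-∧ (λ x y → y ≤ᵇ suc x) (risesOK σ) (suc i ∷ w))) ⟩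
    step σ 0 (suc i) ∧ adjAll (step σ) (suc i ∷ w) ∎
    where
    first-step : ∀ σ i → (i ≡ᵇ 0) ≡ step σ 0 (suc i)
    first-step true  zero    = refl
    first-step true  (suc i) = refl
    first-step false zero    = refl
    first-step false (suc i) = refl

  -- paths β σ k c counts the continuations of a walk at letter c by k letters, all ≥ 1, each
  -- weighted by β σ ℓ for its last letter ℓ.
  paths : (Bool → ℕ → ℕ) → Bool → ℕ → ℕ → ℕ
  paths β σ zero    c = β σ c
  paths β σ (suc k) c = ∑[ i < suc c ] (indicator (step σ c (suc i)) * paths β σ k (suc i))

  anyEnd : Bool → ℕ → ℕ
  anyEnd _ _ = 1

  returns : Bool → ℕ → ℕ
  returns σ c = indicator (step σ c 0)

  ShiftInvariant : (Bool → ℕ → ℕ) → Set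
  ShiftInvariant β = ∀ σ c → β σ (suc c) ≡ β (not σ) c

  walks : Bool → ℕ → List ℕ → Bool
  walks σ c w = adjAll (step σ) (c ∷ w)

  count-walks-suc : ∀ σ m k c →
    count (walks σ c) (wordsOver m (suc k))
      ≡ ∑[ i < m ] (indicator (step σ c (suc i)) * count (walks σ (suc i)) (wordsOver m k))
  count-walks-suc σ m k c = trans (count-wordsOver-suc (walks σ c) m k)
    (sum<-cong m (λ i _ → count-∧ (step σ c (suc i)) (walks σ (suc i)) (wordsOver m k)))

  -- Over an alphabet {1, …, m} with c + k ≤ m the bound m never cuts a walk short.
  count-walks≡paths : ∀ σ k c m → c + k ≤ m → count (walks σ c) (wordsOver m k) ≡ paths anyEnd σ k c
  count-walks≡paths σ zero    c m _     = refl
  count-walks≡paths σ (suc k) c m c+k≤m = begin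
    count (walks σ c) (wordsOver m (suc k))  ≡⟨ count-walks-suc σ m k c ⟩
    sum< m term                              ≡⟨ sum<-truncate term (≤-trans (m≤m+n (suc c) k) 1+c+k≤m) beyond ⟩
    sum< (suc c) term                        ≡⟨ sum<-cong (suc c) (λ i i≤c → cong (indicator (step σ c (suc i)) *_)
                                                  (count-walks≡paths σ k (suc i) m (≤-trans (+-monoˡ-≤ k i≤c) 1+c+k≤m))) ⟩
    paths anyEnd σ (suc k) c                 ∎
    where
    term : ℕ → ℕ
    term i = indicator (step σ c (suc i)) * count (walks σ (suc i)) (wordsOver m k)
    1+c+k≤m : suc c + k ≤ m
    1+c+k≤m = ≤-trans (≤-reflexive (sym (+-suc c k))) c+k≤m
    too-high : ∀ c i → (suc (suc c + i) ≤ᵇ suc c) ≡ false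
    too-high zero    i = refl
    too-high (suc c) i = too-high c i
    beyond : ∀ i → term (suc c + i) ≡ 0
    beyond i rewrite too-high c i = refl

  catalan-count≡paths : ∀ σ n →
    length (filter (λ w → (isCatalan w ∧ rising σ w) Bool.≟ true) (wordsOver n n)) ≡ paths anyEnd σ n 0
  catalan-count≡paths σ zero    = refl
  catalan-count≡paths σ (suc k) = begin
    length (filter (λ w → (isCatalan w ∧ rising σ w) Bool.≟ true) (wordsOver (suc k) (suc k)))
      ≡⟨ length-filter≡count (λ w → isCatalan w ∧ rising σ w) (wordsOver (suc k) (suc k)) ⟩
    count (λ w → isCatalan w ∧ rising σ w) (wordsOver (suc k) (suc k))
      ≡⟨ count-wordsOver-suc-cong (suc k) k (catalan-rising≡walk σ) ⟩
    count (walks σ 0) (wordsOver (suc k) (suc k))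
      ≡⟨ count-walks≡paths σ (suc k) 0 (suc k) ≤-refl ⟩
    paths anyEnd σ (suc k) 0 ∎

  returns-shiftInvariant : ShiftInvariant returns
  returns-shiftInvariant true  c rewrite isEven-suc c with isEven c
  ... | true  = refl
  ... | false = refl
  returns-shiftInvariant false c rewrite isEven-suc c with isEven c
  ... | true  = refl
  ... | false = refl

  paths-from-0 : ∀ β σ k → paths β σ (suc k) 0 ≡ paths β σ k 1
  paths-from-0 β true  k = trans (+-identityʳ _) (+-identityʳ _)
  paths-from-0 β false k = trans (+-identityʳ _) (+-identityʳ _)

  -- A walk from c + 1 either stays above the letter 1, and is then a walk from c raised by one,
  -- or it reaches 1 for the first time after j + 1 letters; from there on it is a walk from 0
  -- whose (forced) first step has been made.
  paths-first-return : ∀ β → ShiftInvariant β → ∀ σ k c →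
    paths β σ k (suc c) ≡ paths β (not σ) k c + ∑[ j < k ] (paths returns (not σ) j c * paths β σ (k ∸ j) 0)
  paths-first-return β β-shift σ zero    c = trans (β-shift σ c) (sym (+-identityʳ _))
  paths-first-return β β-shift σ (suc k) c = begin
    indicator (step σ (suc c) 1) * paths β σ k 1
      + ∑[ i < suc c ] (indicator (step σ (suc c) (suc (suc i))) * paths β σ k (suc (suc i)))
      ≡⟨ cong₂ _+_ (cong₂ _*_ (cong indicator (step-suc σ c 0)) (sym (paths-from-0 β σ k)))
                   (sum<-cong (suc c) (λ i _ → cong₂ _*_ (cong indicator (step-suc σ c (suc i)))
                                                         (paths-first-return β β-shift σ k (suc i)))) ⟩
    E 0 c * G (suc k) + ∑[ i < suc c ] (r i * (paths β σ′ k (suc i) + ∑[ j < k ] (E j (suc i) * G (k ∸ j))))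
      ≡⟨ cong (E 0 c * G (suc k) +_) (expand (suc c)) ⟩
    E 0 c * G (suc k) + (paths β σ′ (suc k) c + ∑[ j < k ] (E (suc j) c * G (k ∸ j)))
      ≡⟨ x∙yz≈y∙xz (E 0 c * G (suc k)) (paths β σ′ (suc k) c) _ ⟩
    paths β σ′ (suc k) c + ∑[ j < suc k ] (E j c * G (suc k ∸ j)) ∎
    where
    σ′ : Bool
    σ′ = not σ
    E : ℕ → ℕ → ℕ
    E = paths returns σ′
    G : ℕ → ℕ
    G l = paths β σ l 0
    r : ℕ → ℕ
    r i = indicator (step σ′ c (suc i))
    expand : ∀ n → ∑[ i < n ] (r i * (paths β σ′ k (suc i) + ∑[ j < k ] (E j (suc i) * G (k ∸ j))))
                 ≡ ∑[ i < n ] (r i * paths β σ′ k (suc i)) + ∑[ j < k ] (∑[ i < n ] (r i * E j (suc i)) * G (k ∸ j))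
    expand n = begin
      ∑[ i < n ] (r i * (paths β σ′ k (suc i) + ∑[ j < k ] (E j (suc i) * G (k ∸ j))))
        ≡⟨ sum<-cong n (λ i _ → *-distribˡ-+ (r i) (paths β σ′ k (suc i)) _) ⟩
      ∑[ i < n ] (r i * paths β σ′ k (suc i) + r i * ∑[ j < k ] (E j (suc i) * G (k ∸ j)))
        ≡⟨ sum<-+ n _ _ ⟩
      ∑[ i < n ] (r i * paths β σ′ k (suc i)) + ∑[ i < n ] (r i * ∑[ j < k ] (E j (suc i) * G (k ∸ j)))
        ≡⟨ cong (∑[ i < n ] (r i * paths β σ′ k (suc i)) +_)
                (sum<-*-sum< n k r (λ j i → E j (suc i)) (λ j → G (k ∸ j))) ⟩
      ∑[ i < n ] (r i * paths β σ′ k (suc i)) + ∑[ j < k ] (∑[ i < n ] (r i * E j (suc i)) * G (k ∸ j)) ∎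

module GeneratingFunctions where

  open PowerSeries
  open Walks
  open import Algebra.Bundles using (CommutativeRing)
  open import Data.Bool using (Bool; true; false; not)
  open import Data.Integer as ℤ using (+_; -_)
  import Data.Integer.Properties as ℤ
  open import Data.Nat as ℕ using (ℕ; zero; suc; _∸_)
  open import Data.Product using (_×_; proj₁; proj₂)
  open import Relation.Binary.PropositionalEquality as ≡ using (_≡_; cong)

  pathSeries : (Bool → ℕ → ℕ) → Bool → Series
  pathSeries β σ = ogf (λ n → paths β σ n 0)

  ogf-⊛-tail : ∀ f g k → (ogf f ⊛ (ogf g ⊖ const (+ g 0))) k ≡ + ∑[ j < k ] (f j ℕ.* g (k ∸ j))
  ogf-⊛-tail f g zero    = ≡.trans (cong (+ f 0 ℤ.*_) (ℤ.+-inverseʳ (+ g 0))) (ℤ.*-zeroʳ (+ f 0))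
  ogf-⊛-tail f g (suc k) = begin
    (ogf f ⊛ (ogf g ⊖ const (+ g 0))) (suc k)
      ≡⟨ shift-⊛ (ogf f) (ogf g ⊖ const (+ g 0)) k ⟩
    + f 0 ℤ.* (+ g (suc k) ℤ.+ + 0) ℤ.+ (ogf (λ j → f (suc j)) ⊛ (ogf g ⊖ const (+ g 0))) k
      ≡⟨ ≡.cong₂ ℤ._+_ (cong (+ f 0 ℤ.*_) (ℤ.+-identityʳ (+ g (suc k)))) (ogf-⊛-tail (λ j → f (suc j)) g k) ⟩
    + f 0 ℤ.* + g (suc k) ℤ.+ + ∑[ j < k ] (f (suc j) ℕ.* g (k ∸ j))
      ≡⟨ cong (ℤ._+ + ∑[ j < k ] (f (suc j) ℕ.* g (k ∸ j))) (ℤ.pos-* (f 0) (g (suc k))) ⟨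
    + (f 0 ℕ.* g (suc k)) ℤ.+ + ∑[ j < k ] (f (suc j) ℕ.* g (k ∸ j))
      ≡⟨ ℤ.pos-+ (f 0 ℕ.* g (suc k)) _ ⟨
    + ∑[ j < suc k ] (f j ℕ.* g (suc k ∸ j)) ∎
    where open ≡.≡-Reasoning

  pathSeries-rec : ∀ β → ShiftInvariant β → ∀ σ →
    pathSeries β σ ≐ const (+ β σ 0)
                     ⊕ X ⊛ (pathSeries β (not σ) ⊕ pathSeries returns (not σ) ⊛ (pathSeries β σ ⊖ const (+ β σ 0)))
  pathSeries-rec β β-shift σ zero    = ≡.sym (ℤ.+-identityʳ _)
  pathSeries-rec β β-shift σ (suc k) = ≡.sym (begin
    + 0 ℤ.+ (X ⊛ (P′ ⊕ E ⊛ (P ⊖ const (+ β σ 0)))) (suc k)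
      ≡⟨ ℤ.+-identityˡ _ ⟩
    (X ⊛ (P′ ⊕ E ⊛ (P ⊖ const (+ β σ 0)))) (suc k)
      ≡⟨ X⊛-suc (P′ ⊕ E ⊛ (P ⊖ const (+ β σ 0))) k ⟩
    + paths β σ′ k 0 ℤ.+ (E ⊛ (P ⊖ const (+ β σ 0))) k
      ≡⟨ cong (ℤ._+_ (+ paths β σ′ k 0)) (ogf-⊛-tail (λ j → paths returns σ′ j 0) (λ l → paths β σ l 0) k) ⟩
    + paths β σ′ k 0 ℤ.+ + ∑[ j < k ] (paths returns σ′ j 0 ℕ.* paths β σ (k ∸ j) 0)
      ≡⟨ ℤ.pos-+ (paths β σ′ k 0) _ ⟨
    + (paths β σ′ k 0 ℕ.+ ∑[ j < k ] (paths returns σ′ j 0 ℕ.* paths β σ (k ∸ j) 0))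
      ≡⟨ cong +_ (paths-first-return β β-shift σ k 0) ⟨
    + paths β σ k 1
      ≡⟨ cong +_ (paths-from-0 β σ k) ⟨
    + paths β σ (suc k) 0 ∎)
    where
    open ≡.≡-Reasoning
    σ′ : Bool
    σ′ = not σ
    P P′ E : Series
    P  = pathSeries β σ
    P′ = pathSeries β σ′
    E  = pathSeries returns σ′

  open CommutativeRing seriesRing using (_≈_; _+_; _*_; _-_; 1#; refl; sym; trans; +-cong; *-cong; -‿cong)
  open LinearCombination (CommutativeRing.ring seriesRing)
  open import Relation.Binary.Reasoning.Setoid (CommutativeRing.setoid seriesRing)

  A B T F : Series
  A = pathSeries anyEnd true
  B = pathSeries anyEnd false
  T = pathSeries returns true
  F = pathSeries returns false

  A-rec : A ≈ 1# + X * (B + F * (A - 1#))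
  A-rec = pathSeries-rec anyEnd (λ _ _ → ≡.refl) true

  B-rec : B ≈ 1# + X * (A + T * (B - 1#))
  B-rec = pathSeries-rec anyEnd (λ _ _ → ≡.refl) false

  T-rec : T ≈ const (+ 0) + X * (F + F * (T - const (+ 0)))
  T-rec = pathSeries-rec returns returns-shiftInvariant true

  F-rec : F ≈ 1# + X * (T + T * (F - 1#))
  F-rec = pathSeries-rec returns returns-shiftInvariant false

  T-F : 1# + T ≈ (1# + X) * F
  T-F = linear-combination₂ 1# (const (- (+ 1))) (certificate X T F) T-rec F-rec
    where
    certificate : ∀ x t f → (1# + t) - (1# + x) * f ≈
      1# * (t - (const (+ 0) + x * (f + f * (t - const (+ 0)))))
      + const (- (+ 1)) * (f - (1# + x * (t + t * (f - 1#))))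
    certificate = solve 3 (λ x t f → (con (+ 1) :+ t) :- (con (+ 1) :+ x) :* f :=
      con (+ 1) :* (t :- (con (+ 0) :+ x :* (f :+ f :* (t :- con (+ 0)))))
      :+ con (- (+ 1)) :* (f :- (con (+ 1) :+ x :* (t :+ t :* (f :- con (+ 1))))))
      (λ _ → ≡.refl)

  T-quadratic : X * ((1# + T) * (1# + T)) ≈ (1# + X) * T
  T-quadratic = linear-combination₂ (const (- (+ 1)) - X) (X * (1# + T)) (certificate X T F) T-rec T-F
    where
    certificate : ∀ x t f → x * ((1# + t) * (1# + t)) - (1# + x) * t ≈
      (const (- (+ 1)) - x) * (t - (const (+ 0) + x * (f + f * (t - const (+ 0)))))
      + (x * (1# + t)) * ((1# + t) - (1# + x) * f)
    certificate = solve 3 (λ x t f → x :* ((con (+ 1) :+ t) :* (con (+ 1) :+ t)) :- (con (+ 1) :+ x) :* t :=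
      (con (- (+ 1)) :- x) :* (t :- (con (+ 0) :+ x :* (f :+ f :* (t :- con (+ 0)))))
      :+ (x :* (con (+ 1) :+ t)) :* ((con (+ 1) :+ t) :- (con (+ 1) :+ x) :* f))
      (λ _ → ≡.refl)

  U V : Series
  U = (1# + X) * B - 1# - const (+ 2) * T
  V = (1# + X) * A - 1# - const (+ 2) * T - X * T

  U-rec : U ≈ X * (V + T * U)
  U-rec = linear-combination₂ (1# + X) (const (+ 2)) (certificate X A B T) B-rec T-quadratic
    where
    certificate : ∀ x a b t →
      ((1# + x) * b - 1# - const (+ 2) * t)
      - x * (((1# + x) * a - 1# - const (+ 2) * t - x * t) + t * ((1# + x) * b - 1# - const (+ 2) * t)) ≈
      (1# + x) * (b - (1# + x * (a + t * (b - 1#))))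
      + const (+ 2) * (x * ((1# + t) * (1# + t)) - (1# + x) * t)
    certificate = solve 4 (λ x a b t →
      let u = (con (+ 1) :+ x) :* b :- con (+ 1) :- con (+ 2) :* t
          v = (con (+ 1) :+ x) :* a :- con (+ 1) :- con (+ 2) :* t :- x :* t
      in u :- x :* (v :+ t :* u) :=
      (con (+ 1) :+ x) :* (b :- (con (+ 1) :+ x :* (a :+ t :* (b :- con (+ 1)))))
      :+ con (+ 2) :* (x :* ((con (+ 1) :+ t) :* (con (+ 1) :+ t)) :- (con (+ 1) :+ x) :* t))
      (λ _ → ≡.refl)

  V-rec : V ≈ X * (U + F * V)
  V-rec = linear-combination₃ (1# + X) (const (- (+ 2)) - X) (const (+ 2) * X) (certificate X A B T F) A-rec T-rec T-F
    where
    certificate : ∀ x a b t f →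
      ((1# + x) * a - 1# - const (+ 2) * t - x * t)
      - x * (((1# + x) * b - 1# - const (+ 2) * t) + f * ((1# + x) * a - 1# - const (+ 2) * t - x * t)) ≈
      (1# + x) * (a - (1# + x * (b + f * (a - 1#))))
      + (const (- (+ 2)) - x) * (t - (const (+ 0) + x * (f + f * (t - const (+ 0)))))
      + (const (+ 2) * x) * ((1# + t) - (1# + x) * f)
    certificate = solve 5 (λ x a b t f →
      let u = (con (+ 1) :+ x) :* b :- con (+ 1) :- con (+ 2) :* t
          v = (con (+ 1) :+ x) :* a :- con (+ 1) :- con (+ 2) :* t :- x :* t
      in v :- x :* (u :+ f :* v) :=
      (con (+ 1) :+ x) :* (a :- (con (+ 1) :+ x :* (b :+ f :* (a :- con (+ 1)))))
      :+ (con (- (+ 2)) :- x) :* (t :- (con (+ 0) :+ x :* (f :+ f :* (t :- con (+ 0)))))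
      :+ (con (+ 2) :* x) :* ((con (+ 1) :+ t) :- (con (+ 1) :+ x) :* f))
      (λ _ → ≡.refl)

  U≈0×V≈0 : U ≈ const (+ 0) × V ≈ const (+ 0)
  U≈0×V≈0 = X-system-trivial {G = T} {H = F} U-rec V-rec

  √Δ : Series
  √Δ = 1# - X - const (+ 2) * X * T

  √Δ-square : √Δ * √Δ ≈ poly (+ 1) (- (+ 2)) (- (+ 3))
  √Δ-square = trans (linear-combination₁ (const (+ 4) * X) (certificate X T) T-quadratic) (sym (poly≐ _ _ _))
    where
    certificate : ∀ x t →
      (1# - x - const (+ 2) * x * t) * (1# - x - const (+ 2) * x * t)
      - (1# + x * (const (- (+ 2)) + x * const (- (+ 3)))) ≈
      (const (+ 4) * x) * (x * ((1# + t) * (1# + t)) - (1# + x) * t)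
    certificate = solve 2 (λ x t →
      let s = con (+ 1) :- x :- con (+ 2) :* x :* t
      in s :* s :- (con (+ 1) :+ x :* (con (- (+ 2)) :+ x :* con (- (+ 3)))) :=
      (con (+ 4) :* x) :* (x :* ((con (+ 1) :+ t) :* (con (+ 1) :+ t)) :- (con (+ 1) :+ x) :* t))
      (λ _ → ≡.refl)

  b-generatingFunction : poly (+ 0) (+ 1) (+ 1) * ogf b ≈ poly (+ 1) (+ 0) (+ 0) - √Δ
  b-generatingFunction = begin
    poly (+ 0) (+ 1) (+ 1) * ogf b ≈⟨ *-cong (poly≐ _ _ _) (λ n → cong +_ (catalan-count≡paths false n)) ⟩
    (const (+ 0) + X * (1# + X * 1#)) * B ≈⟨ linear-combination₁ X (certificate X B T) (proj₁ U≈0×V≈0) ⟩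
    (1# + X * (const (+ 0) + X * const (+ 0))) - √Δ ≈⟨ +-cong (poly≐ _ _ _) refl ⟨
    poly (+ 1) (+ 0) (+ 0) - √Δ ∎
    where
    certificate : ∀ x b t →
      (const (+ 0) + x * (1# + x * 1#)) * b
      - ((1# + x * (const (+ 0) + x * const (+ 0))) - (1# - x - const (+ 2) * x * t)) ≈
      x * (((1# + x) * b - 1# - const (+ 2) * t) - const (+ 0))
    certificate = solve 3 (λ x b t →
      (con (+ 0) :+ x :* (con (+ 1) :+ x :* con (+ 1))) :* b
      :- ((con (+ 1) :+ x :* (con (+ 0) :+ x :* con (+ 0))) :- (con (+ 1) :- x :- con (+ 2) :* x :* t)) :=
      x :* (((con (+ 1) :+ x) :* b :- con (+ 1) :- con (+ 2) :* t) :- con (+ 0)))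
      (λ _ → ≡.refl)

  a-generatingFunction : poly (+ 0) (+ 2) (+ 2) * ogf a ≈
                         poly (+ 2) (- (+ 1)) (+ 0) * poly (+ 1) (+ 1) (+ 0) - poly (+ 2) (+ 1) (+ 0) * √Δ
  a-generatingFunction = begin
    poly (+ 0) (+ 2) (+ 2) * ogf a
      ≈⟨ *-cong (poly≐ _ _ _) (λ n → cong +_ (catalan-count≡paths true n)) ⟩
    (const (+ 0) + X * (const (+ 2) + X * const (+ 2))) * A
      ≈⟨ linear-combination₁ (const (+ 2) * X) (certificate X A T) (proj₂ U≈0×V≈0) ⟩
    (const (+ 2) + X * (const (- (+ 1)) + X * const (+ 0))) * (1# + X * (1# + X * const (+ 0)))
      - (const (+ 2) + X * (1# + X * const (+ 0))) * √Δ
      ≈⟨ +-cong (*-cong (poly≐ _ _ _) (poly≐ _ _ _)) (-‿cong (*-cong (poly≐ _ _ _) (refl {√Δ}))) ⟨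
    poly (+ 2) (- (+ 1)) (+ 0) * poly (+ 1) (+ 1) (+ 0) - poly (+ 2) (+ 1) (+ 0) * √Δ ∎
    where
    certificate : ∀ x a t →
      (const (+ 0) + x * (const (+ 2) + x * const (+ 2))) * a
      - ((const (+ 2) + x * (const (- (+ 1)) + x * const (+ 0))) * (1# + x * (1# + x * const (+ 0)))
         - (const (+ 2) + x * (1# + x * const (+ 0))) * (1# - x - const (+ 2) * x * t)) ≈
      (const (+ 2) * x) * (((1# + x) * a - 1# - const (+ 2) * t - x * t) - const (+ 0))
    certificate = solve 3 (λ x a t →
      (con (+ 0) :+ x :* (con (+ 2) :+ x :* con (+ 2))) :* a
      :- ((con (+ 2) :+ x :* (con (- (+ 1)) :+ x :* con (+ 0))) :* (con (+ 1) :+ x :* (con (+ 1) :+ x :* con (+ 0)))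
          :- (con (+ 2) :+ x :* (con (+ 1) :+ x :* con (+ 0))) :* (con (+ 1) :- x :- con (+ 2) :* x :* t)) :=
      (con (+ 2) :* x) :* (((con (+ 1) :+ x) :* a :- con (+ 1) :- con (+ 2) :* t :- x :* t) :- con (+ 0)))
      (λ _ → ≡.refl)

open import Data.Integer using (+_; -_)
open import Data.Product using (∃; _×_; _,_)
open import Relation.Binary.PropositionalEquality using (_≡_; refl)
open GeneratingFunctions using (√Δ; √Δ-square; a-generatingFunction; b-generatingFunction)

theorem10 : ∃ λ S →
    (S 0 ≡ + 1)
    × (S ⊛ S ≐ poly (+ 1) (- (+ 2)) (- (+ 3)))
    × (poly (+ 0) (+ 2) (+ 2) ⊛ ogf a
    ≐ poly (+ 2) (- (+ 1)) (+ 0) ⊛ poly (+ 1) (+ 1) (+ 0) ⊖ poly (+ 2) (+ 1) (+ 0) ⊛ S)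
    × (poly (+ 0) (+ 1) (+ 1) ⊛ ogf b ≐ poly (+ 1) (+ 0) (+ 0) ⊖ S)
theorem10 = √Δ , refl , √Δ-square , a-generatingFunction , b-generatingFunction
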